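{- Let $d$ be an integer with $d>2$. Then there is no permutation $\pi$ of $\{1,2,\ldots,d\}$ such that $\chi_d(x_1,x_2,\ldots,x_d)=s_d(x_{\pi(1)},x_{\pi(2)},\ldots,x_{\pi(d)})$ for all $(x_1,\ldots,x_d)\in\mathbb{N}^d$. That is, $\chi_d$ cannot be obtained by permuting the arguments of $s_d$.
   Context: $\mathbb{N}$ denotes the set of non-negative integers. For each positive integer $d$, Skolem's function is $s_d(x_1,\ldots,x_d)=\sum_{i=1}^d\binom{x_1+x_2+\cdots+x_i+i-1}{i}$, and Chowla's function is $\chi_d(x_1,\ldots,x_d)=\binom{x_1+\cdots+x_d+d}{d}-1-\sum_{i=1}^{d-1}\binom{x_{i+1}+\cdots+x_d+d-i-1}{d-i}$. Both are bijections from $\mathbb{N}^d$ to $\mathbb{N}$ (known facts). -}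

module Defs where

open import Data.Nat using (ℕ; zero; suc; _+_; _∸_; _<_; _≤_; _<?_)
open import Relation.Nullary using (yes; no)
open import Data.Nat.Combinatorics using (_C_)
open import Data.Fin using (Fin; toℕ; fromℕ<)
open import Data.Fin.Permutation using (Permutation′; _⟨$⟩ʳ_)

sumFromTo : ℕ → ℕ → (ℕ → ℕ) → ℕ
sumFromTo a b f = go (suc b ∸ a)
  where
  go : ℕ → ℕ
  go zero = 0
  go (suc k) = go k + f (a + k)

-- A point of ℕ^d is a function Fin d → ℕ.  The paper's 1-based coordinate
-- x_j (1 ≤ j ≤ d) is  coord x j = x (fromℕ< (j-1 < d)), and 0 out of range
-- (never used out of range below).
coord : {d : ℕ} → (Fin d → ℕ) → ℕ → ℕ
coord {d} x zero = 0
coord {d} x (suc j) with j <? d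
... | yes p = x (fromℕ< p)
... | no _ = 0

skolem : (d : ℕ) → (Fin d → ℕ) → ℕ
skolem d x = sumFromTo 1 d λ i → (sumFromTo 1 i (coord x) + (i ∸ 1)) C i

-- Chowla:  χ_d(x) = C(x_1+...+x_d + d, d) - 1 - Σ_{i=1}^{d-1} C(x_{i+1}+...+x_d + d-i-1, d-i)
-- (truncated subtraction; the true value is a natural number since χ_d maps into ℕ)
chowla : (d : ℕ) → (Fin d → ℕ) → ℕ
chowla d x = ((sumFromTo 1 d (coord x) + d) C d) ∸ 1
  ∸ sumFromTo 1 (d ∸ 1) (λ i → (sumFromTo (suc i) d (coord x) + (d ∸ i ∸ 1)) C (d ∸ i))

permuteArgs : {d : ℕ} → Permutation′ d → (Fin d → ℕ) → (Fin d → ℕ)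
permuteArgs π x j = x (π ⟨$⟩ʳ j)

module Submission where

-- Evaluate both sides of  χ_d(x) = s_d(x ∘ π)  at the points  c·e_k
-- (value c in coordinate k, 0 elsewhere; coordinates counted from 0).
--   * At unit vectors:  s_d(e_k) = d − k,  while  χ_d(e_0) = d  and  χ_d(e_1) = d − 1.
--     Since  e_a ∘ π = e_{π⁻¹(a)},  this forces  π⁻¹  to fix the coordinates 0 and 1.
--   * At doubled unit vectors:  s_d(2e_0) = 2 + s_d(2e_1)  with  s_d(2e_1) > 0,  while
--     χ_d(2e_1) = χ_d(2e_0) − d.

open import Defs
open import Data.Nat using (ℕ; zero; suc; _+_; _∸_; _<_; _≤_; _<?_; z≤n; s≤s)
open import Data.Nat.Properties
open import Data.Nat.Combinatorics using (_C_; nCn≡1; nC1≡n; nCk≡nC[n∸k]; k>n⇒nCk≡0)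
open import Data.Fin using (Fin; toℕ) renaming (zero to fzero; suc to fsuc)
open import Data.Fin.Properties using (toℕ-fromℕ<; toℕ-injective; toℕ<n) renaming (_≟_ to _≟F_)
open import Data.Fin.Permutation using (Permutation′; _⟨$⟩ʳ_; _⟨$⟩ˡ_; inverseˡ; inverseʳ)
open import Data.Product using (Σ; _,_)
open import Data.Empty using (⊥-elim)
open import Relation.Binary.PropositionalEquality
  using (_≡_; _≢_; refl; sym; trans; cong; cong₂; subst; module ≡-Reasoning)
open import Relation.Nullary using (¬_; yes; no)

open ≡-Reasoning

sumBelow : ℕ → (ℕ → ℕ) → ℕ
sumBelow zero    g = 0
sumBelow (suc n) g = sumBelow n g + g n

sumBelow-cong : ∀ n {g h : ℕ → ℕ} → (∀ m → g m ≡ h m) → sumBelow n g ≡ sumBelow n h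
sumBelow-cong zero    g≡h = refl
sumBelow-cong (suc n) g≡h = cong₂ _+_ (sumBelow-cong n g≡h) (g≡h n)

sumBelow-cong< : ∀ n {g h : ℕ → ℕ} → (∀ m → m < n → g m ≡ h m) → sumBelow n g ≡ sumBelow n h
sumBelow-cong< zero    g≡h = refl
sumBelow-cong< (suc n) g≡h =
  cong₂ _+_ (sumBelow-cong< n (λ m m<n → g≡h m (m<n⇒m<1+n m<n))) (g≡h n (n<1+n n))

sumBelow-zero : ∀ n → sumBelow n (λ _ → 0) ≡ 0
sumBelow-zero zero    = refl
sumBelow-zero (suc n) = trans (+-identityʳ _) (sumBelow-zero n)

sumBelow-shift : ∀ n (g : ℕ → ℕ) → sumBelow (suc n) g ≡ g 0 + sumBelow n (λ j → g (suc j))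
sumBelow-shift zero    g = sym (+-identityʳ (g 0))
sumBelow-shift (suc n) g = trans (cong (_+ g (suc n)) (sumBelow-shift n g)) (+-assoc (g 0) _ _)

-- The loop computing  sumFromTo a b f  sees  b  only through the number  suc b ∸ a
-- of summands: with no summands it is 0, and one more summand appends  f (a + k).
sumFromTo-empty : ∀ a b f → suc b ∸ a ≡ 0 → sumFromTo a b f ≡ 0
sumFromTo-empty a b f length with suc b ∸ a | length
... | .0 | refl = refl

sumFromTo-snoc : ∀ a b b′ f k → suc b ∸ a ≡ suc k → suc b′ ∸ a ≡ k →
                 sumFromTo a b f ≡ sumFromTo a b′ f + f (a + k)
sumFromTo-snoc a b b′ f k length length′ with suc b ∸ a | length | suc b′ ∸ a | length′
... | .(suc k) | refl | .k | refl = refl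

sumFromTo-sumBelow : ∀ i b f → sumFromTo (suc i) b f ≡ sumBelow (b ∸ i) (λ j → f (suc i + j))
sumFromTo-sumBelow i b f = byLength (b ∸ i) b refl
  where
  byLength : ∀ k b → b ∸ i ≡ k → sumFromTo (suc i) b f ≡ sumBelow k (λ j → f (suc i + j))
  byLength zero    b length = sumFromTo-empty (suc i) b f length
  byLength (suc k) b length =
    trans (sumFromTo-snoc (suc i) b (i + k) f k length (m+n∸m≡n i k))
          (cong (_+ f (suc i + k)) (byLength k (i + k) (m+n∸m≡n i k)))

coord-padded : ∀ {d} (x : Fin d → ℕ) (f : ℕ → ℕ) → (∀ i → x i ≡ f (toℕ i)) →
               (∀ j → d ≤ j → f j ≡ 0) → ∀ j → coord x (suc j) ≡ f j
coord-padded {d} x f agrees vanishes j with j <? d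
... | yes j<d = trans (agrees _) (cong f (toℕ-fromℕ< j<d))
... | no  j≮d = sym (vanishes j (≮⇒≥ j≮d))

skolemF : ℕ → (ℕ → ℕ) → ℕ
skolemF d f = sumBelow d (λ m → (sumBelow (suc m) f + m) C suc m)

skolem-padded : ∀ d (x : Fin d → ℕ) (f : ℕ → ℕ) → (∀ i → x i ≡ f (toℕ i)) →
                (∀ j → d ≤ j → f j ≡ 0) → skolem d x ≡ skolemF d f
skolem-padded d x f agrees vanishes =
  trans (sumFromTo-sumBelow 0 d _) (sumBelow-cong d λ m →
    cong (λ s → (s + m) C suc m)
      (trans (sumFromTo-sumBelow 0 (suc m) (coord x))
             (sumBelow-cong (suc m) (coord-padded x f agrees vanishes))))

chowlaTerm : ℕ → (ℕ → ℕ) → ℕ → ℕ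
chowlaTerm e f m = (sumBelow (e ∸ m) (λ j → f (suc m + j)) + (e ∸ m ∸ 1)) C (e ∸ m)

chowlaF : ℕ → (ℕ → ℕ) → ℕ
chowlaF e f = ((sumBelow (suc e) f + suc e) C suc e) ∸ 1 ∸ sumBelow e (chowlaTerm e f)

chowla-padded : ∀ e (x : Fin (suc e) → ℕ) (f : ℕ → ℕ) → (∀ i → x i ≡ f (toℕ i)) →
                (∀ j → suc e ≤ j → f j ≡ 0) → chowla (suc e) x ≡ chowlaF e f
chowla-padded e x f agrees vanishes = cong₂ _∸_
  (cong (λ s → ((s + suc e) C suc e) ∸ 1) (coordinateSum 0 (suc e)))
  (trans (sumFromTo-sumBelow 0 e _) (sumBelow-cong e λ m →
     cong (λ s → (s + (e ∸ m ∸ 1)) C (e ∸ m)) (coordinateSum (suc m) (suc e))))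
  where
  coordinateSum : ∀ i b → sumFromTo (suc i) b (coord x) ≡ sumBelow (b ∸ i) (λ j → f (i + j))
  coordinateSum i b = trans (sumFromTo-sumBelow i b (coord x))
                            (sumBelow-cong (b ∸ i) (λ j → coord-padded x f agrees vanishes (i + j)))

-- The spike  spike c k = c·e_k  and its prefix sums  step c k m = [k ≤ m]·c.
spike : ℕ → ℕ → ℕ → ℕ
spike c zero    zero    = c
spike c zero    (suc j) = 0
spike c (suc k) zero    = 0
spike c (suc k) (suc j) = spike c k j

step : ℕ → ℕ → ℕ → ℕ
step c zero    m       = c
step c (suc k) zero    = 0
step c (suc k) (suc m) = step c k m

spike-hit : ∀ c {k j} → j ≡ k → spike c k j ≡ c
spike-hit c {zero}  refl = refl
spike-hit c {suc k} refl = spike-hit c {k} refl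

spike-miss : ∀ c {k j} → j ≢ k → spike c k j ≡ 0
spike-miss c {zero}  {zero}  j≢k = ⊥-elim (j≢k refl)
spike-miss c {zero}  {suc j} j≢k = refl
spike-miss c {suc k} {zero}  j≢k = refl
spike-miss c {suc k} {suc j} j≢k = spike-miss c (λ j≡k → j≢k (cong suc j≡k))

spike-beyond : ∀ c {k d j} → k < d → d ≤ j → spike c k j ≡ 0
spike-beyond c k<d d≤j = spike-miss c (λ j≡k → <-irrefl (sym j≡k) (<-≤-trans k<d d≤j))

prefix-spike : ∀ c k m → sumBelow (suc m) (spike c k) ≡ step c k m
prefix-spike c zero    m       =
  trans (sumBelow-shift m (spike c 0)) (trans (cong (c +_) (sumBelow-zero m)) (+-identityʳ c))
prefix-spike c (suc k) zero    = refl
prefix-spike c (suc k) (suc m) = trans (sumBelow-shift (suc m) (spike c (suc k))) (prefix-spike c k m)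

step-≤ : ∀ c k m → step c k m ≤ c
step-≤ c zero    m       = ≤-refl
step-≤ c (suc k) zero    = z≤n
step-≤ c (suc k) (suc m) = step-≤ c k m

sumBelow-step : ∀ d k → sumBelow d (step 1 k) ≡ d ∸ k
sumBelow-step zero    k       = sym (0∸n≡0 k)
sumBelow-step (suc d) zero    = trans (cong (_+ 1) (sumBelow-step d 0)) (+-comm d 1)
sumBelow-step (suc d) (suc k) = trans (sumBelow-shift d (step 1 (suc k))) (sumBelow-step d k)

succ-choose : ∀ n → suc n C n ≡ suc n
succ-choose n = begin
  suc n C n             ≡⟨ nCk≡nC[n∸k] (n≤1+n n) ⟩
  suc n C (suc n ∸ n)   ≡⟨ cong (suc n C_) (m+n∸n≡m 1 n) ⟩
  suc n C 1             ≡⟨ nC1≡n (suc n) ⟩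
  suc n                 ∎

choose-bit : ∀ m b → b ≤ 1 → (b + m) C suc m ≡ b
choose-bit m zero          _             = k>n⇒nCk≡0 (n<1+n m)
choose-bit m (suc zero)    _             = nCn≡1 (suc m)
choose-bit m (suc (suc b)) (s≤s ())

pred-choose : ∀ n → 0 < n → (n ∸ 1) C n ≡ 0
pred-choose (suc r) _ = k>n⇒nCk≡0 (n<1+n r)

skolem-spike : ∀ d c k → skolemF d (spike c k) ≡ sumBelow d (λ m → (step c k m + m) C suc m)
skolem-spike d c k = sumBelow-cong d (λ m → cong (λ s → (s + m) C suc m) (prefix-spike c k m))

skolem-unit : ∀ d k → skolemF d (spike 1 k) ≡ d ∸ k
skolem-unit d k = begin
  skolemF d (spike 1 k)                           ≡⟨ skolem-spike d 1 k ⟩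
  sumBelow d (λ m → (step 1 k m + m) C suc m)     ≡⟨ sumBelow-cong d (λ m → choose-bit m _ (step-≤ 1 k m)) ⟩
  sumBelow d (step 1 k)                           ≡⟨ sumBelow-step d k ⟩
  d ∸ k                                           ∎

-- s_d(c·e_0) = c + s_d(c·e_1): the two evaluations differ only in the term m = 0.
skolem-spike-shift : ∀ e c → skolemF (suc e) (spike c 0) ≡ c + skolemF (suc e) (spike c 1)
skolem-spike-shift e c = begin
  skolemF (suc e) (spike c 0)                          ≡⟨ skolem-spike (suc e) c 0 ⟩
  sumBelow (suc e) (λ m → (c + m) C suc m)             ≡⟨ sumBelow-shift e _ ⟩
  (c + 0) C 1 + later                                  ≡⟨ cong (_+ later) (trans (cong (_C 1) (+-identityʳ c)) (nC1≡n c)) ⟩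
  c + later                                            ≡⟨ cong (c +_) (sym (trans (skolem-spike (suc e) c 1) (sumBelow-shift e _))) ⟩
  c + skolemF (suc e) (spike c 1)                      ∎
  where
  later : ℕ
  later = sumBelow e (λ m → (c + suc m) C suc (suc m))

-- s_d(2e_1) > 0 for d ≥ 2: its term m = 1 is C(3, 2) = 3.
skolem-double-positive : ∀ e → 0 < skolemF (suc (suc e)) (spike 2 1)
skolem-double-positive e =
  subst (0 <_) (sym (trans (skolem-spike (suc (suc e)) 2 1)
                           (trans (sumBelow-shift (suc e) _) (sumBelow-shift e _))))
        (s≤s z≤n)

-- In χ at c·e_0 every subtracted term vanishes (all tail sums are 0).
chowlaTail-spike0 : ∀ e c → sumBelow e (chowlaTerm e (spike c 0)) ≡ 0
chowlaTail-spike0 e c = trans (sumBelow-cong< e vanishing) (sumBelow-zero e)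
  where
  vanishing : ∀ m → m < e → chowlaTerm e (spike c 0) m ≡ 0
  vanishing m m<e =
    trans (cong (λ s → (s + (e ∸ m ∸ 1)) C (e ∸ m)) (sumBelow-zero (e ∸ m)))
          (pred-choose (e ∸ m) (m<n⇒0<n∸m m<e))

-- In χ at c·e_1 only the term m = 0 survives; the others are the terms at c·e_0
-- in one dimension less.
chowlaTail-spike1 : ∀ e c → sumBelow (suc e) (chowlaTerm (suc e) (spike c 1)) ≡ (c + e) C suc e
chowlaTail-spike1 e c = begin
  sumBelow (suc e) (chowlaTerm (suc e) (spike c 1))
    ≡⟨ sumBelow-shift e _ ⟩
  chowlaTerm (suc e) (spike c 1) 0 + sumBelow e (chowlaTerm e (spike c 0))
    ≡⟨ cong₂ _+_ (cong (λ s → (s + e) C suc e) (prefix-spike c 0 e)) (chowlaTail-spike0 e c) ⟩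
  (c + e) C suc e + 0
    ≡⟨ +-identityʳ _ ⟩
  (c + e) C suc e
    ∎

chowla-spike0 : ∀ e c → chowlaF e (spike c 0) ≡ ((c + suc e) C suc e) ∸ 1
chowla-spike0 e c =
  cong₂ _∸_ (cong (λ s → ((s + suc e) C suc e) ∸ 1) (prefix-spike c 0 e)) (chowlaTail-spike0 e c)

chowla-spike1 : ∀ e c → chowlaF (suc e) (spike c 1) ≡ chowlaF (suc e) (spike c 0) ∸ ((c + e) C suc e)
chowla-spike1 e c = begin
  chowlaF (suc e) (spike c 1)
    ≡⟨ cong₂ _∸_ (cong (λ s → ((s + suc (suc e)) C suc (suc e)) ∸ 1) (prefix-spike c 1 (suc e)))
                 (chowlaTail-spike1 e c) ⟩
  ((c + suc (suc e)) C suc (suc e)) ∸ 1 ∸ ((c + e) C suc e)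
    ≡⟨ cong (_∸ ((c + e) C suc e)) (sym (chowla-spike0 (suc e) c)) ⟩
  chowlaF (suc e) (spike c 0) ∸ ((c + e) C suc e)
    ∎

chowla-unit0 : ∀ e → chowlaF e (spike 1 0) ≡ suc e
chowla-unit0 e = trans (chowla-spike0 e 1) (cong (_∸ 1) (succ-choose (suc e)))

chowla-unit1 : ∀ e → chowlaF (suc e) (spike 1 1) ≡ suc e
chowla-unit1 e = trans (chowla-spike1 e 1) (cong₂ _∸_ (chowla-unit0 (suc e)) (nCn≡1 (suc e)))

spikeAt : ∀ {d} → ℕ → Fin d → Fin d → ℕ
spikeAt c a i = spike c (toℕ a) (toℕ i)

permute-spike : ∀ {d} (π : Permutation′ d) c (a j : Fin d) →
                spike c (toℕ a) (toℕ (π ⟨$⟩ʳ j)) ≡ spike c (toℕ (π ⟨$⟩ˡ a)) (toℕ j)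
permute-spike π c a j with π ⟨$⟩ʳ j ≟F a
... | yes πj≡a = trans (spike-hit c (cong toℕ πj≡a)) (sym (spike-hit c (cong toℕ j≡π⁻¹a)))
  where
  j≡π⁻¹a : j ≡ π ⟨$⟩ˡ a
  j≡π⁻¹a = trans (sym (inverseˡ π)) (cong (π ⟨$⟩ˡ_) πj≡a)
... | no  πj≢a = trans (spike-miss c (λ e → πj≢a (toℕ-injective e)))
                       (sym (spike-miss c (λ e → πj≢a (π⁻¹a≡j⇒πj≡a (toℕ-injective e)))))
  where
  π⁻¹a≡j⇒πj≡a : j ≡ π ⟨$⟩ˡ a → π ⟨$⟩ʳ j ≡ a
  π⁻¹a≡j⇒πj≡a j≡π⁻¹a = trans (cong (π ⟨$⟩ʳ_) j≡π⁻¹a) (inverseʳ π)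

skolem-permuted-spike : ∀ {d} (π : Permutation′ d) c (a : Fin d) →
                        skolem d (permuteArgs π (spikeAt c a)) ≡ skolemF d (spike c (toℕ (π ⟨$⟩ˡ a)))
skolem-permuted-spike {d} π c a =
  skolem-padded d _ _ (permute-spike π c a) (λ j → spike-beyond c (toℕ<n (π ⟨$⟩ˡ a)))

chowla-spike : ∀ e c (a : Fin (suc e)) → chowla (suc e) (spikeAt c a) ≡ chowlaF e (spike c (toℕ a))
chowla-spike e c a = chowla-padded e _ _ (λ i → refl) (λ j → spike-beyond c (toℕ<n a))

no-room : ∀ X d → 0 < X → 2 < d → (2 + X) ∸ d ≢ X
no-room (suc Y) d _ 2<d eq = 1+n≰n (subst (_≤ Y) eq (∸-monoʳ-≤ (3 + Y) 2<d))

chowla-double-drop : ∀ e → chowlaF (suc e) (spike 2 1) ≡ chowlaF (suc e) (spike 2 0) ∸ suc (suc e)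
chowla-double-drop e =
  trans (chowla-spike1 e 2) (cong (chowlaF (suc e) (spike 2 0) ∸_) (succ-choose (suc e)))

agree-on-spikes : ∀ e (π : Permutation′ (suc e)) →
                  (∀ x → chowla (suc e) x ≡ skolem (suc e) (permuteArgs π x)) →
                  ∀ c a → chowlaF e (spike c (toℕ a)) ≡ skolemF (suc e) (spike c (toℕ (π ⟨$⟩ˡ a)))
agree-on-spikes e π agree c a =
  trans (sym (chowla-spike e c a)) (trans (agree (spikeAt c a)) (skolem-permuted-spike π c a))

-- Comparing unit vectors (s(e_k) = d − k): if moreover  χ_{1+e}(e_a) = 1 + e − a,
-- then  π⁻¹  fixes the coordinate a.
fixed-coordinate : ∀ e (π : Permutation′ (suc e)) →
                   (∀ x → chowla (suc e) x ≡ skolem (suc e) (permuteArgs π x)) →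
                   ∀ a → chowlaF e (spike 1 (toℕ a)) ≡ suc e ∸ toℕ a → toℕ (π ⟨$⟩ˡ a) ≡ toℕ a
fixed-coordinate e π agree a χ[eₐ] =
  ∸-cancelˡ-≡ (<⇒≤ (toℕ<n (π ⟨$⟩ˡ a))) (<⇒≤ (toℕ<n a)) (begin
    suc e ∸ toℕ (π ⟨$⟩ˡ a)                  ≡⟨ skolem-unit (suc e) (toℕ (π ⟨$⟩ˡ a)) ⟨
    skolemF (suc e) (spike 1 (toℕ (π ⟨$⟩ˡ a))) ≡⟨ agree-on-spikes e π agree 1 a ⟨
    chowlaF e (spike 1 (toℕ a))            ≡⟨ χ[eₐ] ⟩
    suc e ∸ toℕ a                          ∎)

theorem1 : (d : ℕ) → 2 < d →
    ¬ (Σ (Permutation′ d) λ π →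
         (x : Fin d → ℕ) → chowla d x ≡ skolem d (permuteArgs π x))
theorem1 (suc zero)          (s≤s ())
theorem1 (suc (suc zero))    (s≤s (s≤s ()))
theorem1 (suc (suc (suc n))) 2<d (π , agree) =
  no-room X d (skolem-double-positive (suc n)) 2<d (begin
    (2 + X) ∸ d                ≡⟨ cong (_∸ d) at2e₀ ⟨
    chowlaF e (spike 2 0) ∸ d  ≡⟨ chowla-double-drop (suc n) ⟨
    chowlaF e (spike 2 1)      ≡⟨ at2e₁ ⟩
    X                          ∎)
  where
  d e X : ℕ
  d = suc (suc (suc n))
  e = suc (suc n)
  X = skolemF d (spike 2 1)
  -- π⁻¹ fixes the coordinates 0 and 1, so  χ(2e_a) = s(2e_a)  for  a ∈ {0, 1}.
  at2e₀ : chowlaF e (spike 2 0) ≡ 2 + X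
  at2e₀ = trans (agree-on-spikes e π agree 2 fzero)
                (trans (cong (λ k → skolemF d (spike 2 k)) (fixed-coordinate e π agree fzero (chowla-unit0 e)))
                       (skolem-spike-shift e 2))
  at2e₁ : chowlaF e (spike 2 1) ≡ X
  at2e₁ = trans (agree-on-spikes e π agree 2 (fsuc fzero))
                (cong (λ k → skolemF d (spike 2 k)) (fixed-coordinate e π agree (fsuc fzero) (chowla-unit1 (suc n))))
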